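{- Let $q_0,q_1,q_2,r_0,r_1,r_2,t_1,t_2,s$ be pairwise coprime positive integers, let $a_1,a_2$ be integers, and let $n_1,n_2$ be integers with $(n_1,q_0q_1r_0r_1t_1s)=(n_2,q_0q_2r_0r_2t_2s)=(n_1,n_2)=1$. Suppose $\varrho$ is an integer satisfying $$\varrho n_1\equiv a_1\bmod{r_0r_1t_1s},\quad \varrho n_2\equiv a_1\bmod{r_0r_2t_2s},\quad \varrho n_1\equiv a_2\bmod{q_0q_1t_2},\quad \varrho n_2\equiv a_2\bmod{q_0q_2t_1}.$$ Assume $n_1\equiv n_2\bmod{q_0r_0s}$, $a_2n_1\equiv a_1n_2\bmod{t_1}$ and $a_1n_1\equiv a_2n_2\bmod{t_2}$. Then $$\frac{\varrho}{q_0q_1q_2r_0r_1r_2t_1t_2s}\equiv a_1\frac{n_1-n_2}{q_0r_0s}\frac{\overline{q_1r_1t_1n_2}}{q_2r_2t_2n_1}+(a_2-a_1)\frac{\overline{q_0q_2r_0r_1r_2t_1t_2sn_1}}{q_1}+(a_2-a_1)\frac{\overline{q_1r_0r_1r_2t_1t_2sn_2}}{q_0q_2}+\frac{a_1}{q_0q_1q_2r_0r_1r_2t_1t_2sn_1}\bmod 1.$$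
   Context: For a fraction $\frac{\overline{u}}{v}$ with $(u,v)=1$, $\overline{u}$ denotes any integer with $u\overline{u}\equiv1\bmod v$; the value of such a fraction modulo $1$ does not depend on this choice. In the first term, $\frac{n_1-n_2}{q_0r_0s}$ is an integer by assumption, and the congruence is an identity of real numbers modulo $1$. -}

module Defs where

open import Data.Integer using (ℤ; +_; +[1+_]; -[1+_]; _-_; _*_; -_; ∣_∣)
open import Data.Integer.Divisibility using (_∣_)
open import Data.Nat.Coprimality using (Coprime)
open import Data.Product using (∃-syntax)
open import Data.Rational.Unnormalised using (ℚᵘ; _/_; _≃_; 0ℚᵘ)
import Data.Rational.Unnormalised as Q

_≡_[mod_] : ℤ → ℤ → ℤ → Set
a ≡ b [mod m ] = m ∣ (a - b)

CoprimeZ : ℤ → ℤ → Set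
CoprimeZ a b = Coprime ∣ a ∣ ∣ b ∣

-- the rational number u / v  (v any nonzero integer, possibly negative).
-- For v = 0 a junk value 0 is returned; it is never used in the statement.
frac : ℤ → ℤ → ℚᵘ
frac u (+ 0)      = 0ℚᵘ
frac u +[1+ n ]   = u / suc n
  where open import Data.Nat using (suc)
frac u -[1+ n ]   = (- u) / suc n
  where open import Data.Nat using (suc)

infix 4 _≡_[mod_]

_≡₁_ : ℚᵘ → ℚᵘ → Set
x ≡₁ y = ∃[ k ] (x Q.- y ≃ (k / 1))

infix 4 _≡₁_

{-# OPTIONS --safe #-}
module Submission where

-- Put both sides over D = q₀q₁q₂r₀r₁r₂t₁t₂s·n₁: the left side is ϱn₁/D and the right side
-- is N/D for an explicit integer N, so it suffices that D ∣ ϱn₁ − N.  Split D into the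
-- coprime factors A = q₀q₁r₀r₁t₁s and B = q₂r₂t₂n₁.  Modulo r₀r₁t₁s, q₁ and q₀ the
-- congruence ϱn₁ ≡ N is read off the hypotheses (modulo q₀ after multiplying by the unit
-- c₃ = q₁r₀r₁r₂t₁t₂sn₂); modulo B one multiplies by the unit c₁ = q₁r₁t₁n₂ and uses that
-- ϱn₂ ≡ a₁ + (a₂ − a₁)u₃c₃ modulo q₂r₂t₂.  The three factors of A are glued without a coprimality
-- argument, through c₂ = D/q₁ and c₃, each of which vanishes modulo the factors already
-- treated and is a unit modulo the next one; A and B are glued by coprimality.

open import Defs
open import Data.Empty using (⊥-elim)
open import Data.Integer using (ℤ; _<_; _*_; _-_; _+_; -_; +_; +[1+_]; -[1+_]; 0ℤ; 1ℤ; ∣_∣; ≢-nonZero)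
open import Data.Integer.Coprimality using (coprime-divisor)
open import Data.Integer.Divisibility.Signed
  using (_∣_; divides; ∣ᵤ⇒∣; ∣⇒∣ᵤ; ∣-refl; ∣-trans; ∣m∣n⇒∣m+n; ∣m∣n⇒∣m-n; ∣n⇒∣m*n; ∣m⇒∣m*n;
         *-monoʳ-∣; *-monoˡ-∣)
open import Data.Integer.Properties
  using (*-cancelʳ-≡; *-comm; *-assoc; *-identityˡ; *-identityʳ; *-distribʳ-+; neg-distribˡ-*; abs-*;
         i*j≡0⇒i≡0∨j≡0; i≡j⇒i-j≡0; <⇒≢; *-commutativeSemigroup)
open import Algebra.Properties.CommutativeSemigroup *-commutativeSemigroup using (interchange; xy∙z≈xz∙y)
open import Data.Integer.Tactic.RingSolver using (solve; solve-∀)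
open import Data.List using (List; _∷_; []; foldr)
open import Data.List.Relation.Unary.All using (All; _∷_; [])
open import Data.List.Relation.Unary.AllPairs using (AllPairs; _∷_; [])
import Data.Nat.Coprimality as ℕ
import Data.Nat.Divisibility as ℕ
open import Data.Product using (_,_)
open import Data.Rational.Unnormalised using (ℚᵘ; mkℚᵘ; ↥_; ↧_; *≡*)
import Data.Rational.Unnormalised as Q
open import Data.Sum using ([_,_])
open import Relation.Binary.PropositionalEquality
  using (_≡_; _≢_; ≢-sym; refl; sym; trans; cong; cong₂; subst; subst₂; module ≡-Reasoning)

open ≡-Reasoning

*-≢0 : ∀ {i j} → i ≢ 0ℤ → j ≢ 0ℤ → i * j ≢ 0ℤ
*-≢0 {i} i≢0 j≢0 i*j≡0 = [ i≢0 , j≢0 ] (i*j≡0⇒i≡0∨j≡0 i i*j≡0)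

*-pres-∣ : ∀ {a b c d} → a ∣ b → c ∣ d → a * c ∣ b * d
*-pres-∣ {b = b} {c} a∣b c∣d = ∣-trans (*-monoˡ-∣ c a∣b) (*-monoʳ-∣ b c∣d)

m*n∣⇒m∣ : ∀ m n {x} → m * n ∣ x → m ∣ x
m*n∣⇒m∣ m n = ∣-trans (∣m⇒∣m*n n ∣-refl)

m*n∣⇒n∣ : ∀ m n {x} → m * n ∣ x → n ∣ x
m*n∣⇒n∣ m n = ∣-trans (∣n⇒∣m*n m ∣-refl)

private
  unit-split : ∀ x c u → x * c * u - x * (c * u - 1ℤ) ≡ x
  unit-split = solve-∀

∣-cancel-unitʳ : ∀ {n x c u} → n ∣ c * u - 1ℤ → n ∣ x * c → n ∣ x
∣-cancel-unitʳ {n} {x} {c} {u} c-unit n∣xc =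
  subst (n ∣_) (unit-split x c u) (∣m∣n⇒∣m-n (∣m⇒∣m*n u n∣xc) (∣n⇒∣m*n x c-unit))

-- c vanishes modulo m and is a unit modulo n: this witnesses that m and n are coprime.
*∣-via-unit : ∀ {m n x c u} → m ∣ c → n ∣ c * u - 1ℤ → m ∣ x → n ∣ x → m * n ∣ x
*∣-via-unit {m} {n} {x} {c} {u} m∣c c-unit m∣x n∣x =
  subst (m * n ∣_) (unit-split x c u)
    (∣m∣n⇒∣m-n (∣m⇒∣m*n u (subst (m * n ∣_) (*-comm c x) (*-pres-∣ m∣c n∣x)))
               (*-pres-∣ m∣x c-unit))

coprime-*∣ : ∀ {m n x} → CoprimeZ m n → m ∣ x → n ∣ x → m * n ∣ x
coprime-*∣ {m} {n} m⊥n m∣qn (divides q refl) = *-monoˡ-∣ n m∣q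
  where
  m∣q : m ∣ q
  m∣q = ∣ᵤ⇒∣ (coprime-divisor m n q m⊥n (∣⇒∣ᵤ (subst (m ∣_) (*-comm q n) m∣qn)))

coprime-*ˡ : ∀ {a b c} → CoprimeZ a c → CoprimeZ b c → CoprimeZ (a * b) c
coprime-*ˡ {a} {b} {c} a⊥c b⊥c rewrite abs-* a b =
  λ (d∣ab , d∣c) → b⊥c (ℕ.coprime-divisor (d⊥a d∣c) d∣ab , d∣c)
  where
  d⊥a : ∀ {d} → d ℕ.∣ ∣ c ∣ → ℕ.Coprime d ∣ a ∣
  d⊥a d∣c (e∣d , e∣a) = a⊥c (e∣a , ℕ.∣-trans e∣d d∣c)

coprime-*ʳ : ∀ {a b c} → CoprimeZ a b → CoprimeZ a c → CoprimeZ a (b * c)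
coprime-*ʳ {a} {b} {c} a⊥b a⊥c = ℕ.sym (coprime-*ˡ {b} {c} {a} (ℕ.sym a⊥b) (ℕ.sym a⊥c))

-- p = a / b for an arbitrary nonzero integer b (ℚᵘ only has positive denominators, while
-- the denominators of the theorem involve n₁, which may be negative).  A data type rather
-- than the equation itself, so that a and b can be inferred.
infix 4 _≃_÷_
data _≃_÷_ (p : ℚᵘ) (a b : ℤ) : Set where
  cross : ↥ p * b ≡ a * ↧ p → p ≃ a ÷ b

frac-≃÷ : ∀ u {v} → v ≢ 0ℤ → frac u v ≃ u ÷ v
frac-≃÷ u {+ 0}      0≢0 = ⊥-elim (0≢0 refl)
frac-≃÷ u {+[1+ n ]} _   = cross refl
frac-≃÷ u { -[1+ n ]} _   = cross (neg*neg u +[1+ n ])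
  where
  neg*neg : ∀ i j → (- i) * (- j) ≡ i * j
  neg*neg = solve-∀

≃÷-extend : ∀ {p a b} c → p ≃ a ÷ b → p ≃ (a * c) ÷ (b * c)
≃÷-extend {p} {a} {b} c (cross p≃a/b) = cross (begin
  ↥ p * (b * c)   ≡⟨ *-assoc (↥ p) b c ⟨
  ↥ p * b * c     ≡⟨ cong (_* c) p≃a/b ⟩
  a * ↧ p * c     ≡⟨ xy∙z≈xz∙y a (↧ p) c ⟩
  a * c * ↧ p     ∎)

≃÷-rescale : ∀ {p a b c d} → b ≢ 0ℤ → p ≃ a ÷ b → a * d ≡ c * b → p ≃ c ÷ d
≃÷-rescale {p} {a} {b} {c} {d} b≢0 (cross p≃a/b) ad≡cb =
  cross (*-cancelʳ-≡ (↥ p * d) (c * ↧ p) b {{≢-nonZero b≢0}} (begin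
  ↥ p * d * b   ≡⟨ xy∙z≈xz∙y (↥ p) d b ⟩
  ↥ p * b * d   ≡⟨ cong (_* d) p≃a/b ⟩
  a * ↧ p * d   ≡⟨ xy∙z≈xz∙y a (↧ p) d ⟩
  a * d * ↧ p   ≡⟨ cong (_* ↧ p) ad≡cb ⟩
  c * b * ↧ p   ≡⟨ xy∙z≈xz∙y c b (↧ p) ⟩
  c * ↧ p * b   ∎))

*-≃÷ : ∀ {p q a b c d} → p ≃ a ÷ b → q ≃ c ÷ d → p Q.* q ≃ (a * c) ÷ (b * d)
*-≃÷ {mkℚᵘ x m} {mkℚᵘ y n} {a} {b} {c} {d} (cross p≃a/b) (cross q≃c/d) = cross (begin
  x * y * (b * d)                 ≡⟨ interchange x y b d ⟩
  x * b * (y * d)                 ≡⟨ cong₂ _*_ p≃a/b q≃c/d ⟩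
  a * +[1+ m ] * (c * +[1+ n ])   ≡⟨ interchange a +[1+ m ] c +[1+ n ] ⟩
  a * c * (+[1+ m ] * +[1+ n ])   ∎)

scale-≃÷ : ∀ {p a b} c → p ≃ a ÷ b → frac c (+ 1) Q.* p ≃ (c * a) ÷ b
scale-≃÷ {p} {a} {b} c p≃a/b = subst (λ b′ → frac c (+ 1) Q.* p ≃ (c * a) ÷ b′) (*-identityˡ b)
  (*-≃÷ (frac-≃÷ c {+ 1} (λ ())) p≃a/b)

+-≃÷ : ∀ {p q a c d} → p ≃ a ÷ d → q ≃ c ÷ d → p Q.+ q ≃ (a + c) ÷ d
+-≃÷ {mkℚᵘ x m} {mkℚᵘ y n} {a} {c} {d} (cross p≃a/d) (cross q≃c/d) = cross (begin
  (x * N + y * M) * d       ≡⟨ *-distribʳ-+ d (x * N) (y * M) ⟩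
  x * N * d + y * M * d     ≡⟨ cong₂ _+_ (xy∙z≈xz∙y x N d) (xy∙z≈xz∙y y M d) ⟩
  x * d * N + y * d * M     ≡⟨ cong₂ _+_ (cong (_* N) p≃a/d) (cong (_* M) q≃c/d) ⟩
  a * M * N + c * N * M     ≡⟨ collect a c M N ⟩
  (a + c) * (M * N)         ∎)
  where
  M N : ℤ
  M = +[1+ m ]
  N = +[1+ n ]
  collect : ∀ a c M N → a * M * N + c * N * M ≡ (a + c) * (M * N)
  collect = solve-∀

-‿≃÷ : ∀ {p a b} → p ≃ a ÷ b → Q.- p ≃ (- a) ÷ b
-‿≃÷ {mkℚᵘ x m} {a} {b} (cross p≃a/b) = cross (begin
  - x * b          ≡⟨ neg-distribˡ-* x b ⟨
  - (x * b)        ≡⟨ cong -_ p≃a/b ⟩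
  - (a * +[1+ m ]) ≡⟨ neg-distribˡ-* a +[1+ m ] ⟩
  - a * +[1+ m ]   ∎)

≡₁-by-÷ : ∀ {p q a c d} → d ≢ 0ℤ → p ≃ a ÷ d → q ≃ c ÷ d → d ∣ a - c → p ≡₁ q
≡₁-by-÷ {a = a} {c} d≢0 p≃a/d q≃c/d (divides m a-c≡m*d)
  with ≃÷-rescale {c = m} {d = 1ℤ} d≢0 (+-≃÷ p≃a/d (-‿≃÷ q≃c/d)) (trans (*-identityʳ (a - c)) a-c≡m*d)
... | cross p-q≃m/1 = m , *≡* p-q≃m/1

-- k stands for (n₁ − n₂)/(q₀r₀s), and u₁, u₂, u₃ for the inverses of c₁ = q₁r₁t₁n₂,
-- c₂ = q₀q₂r₀r₁r₂t₁t₂sn₁ and c₃ = q₁r₀r₁r₂t₁t₂sn₂.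
module Numerator (q₀ q₁ q₂ r₀ r₁ r₂ t₁ t₂ s a₁ a₂ n₁ n₂ ϱ k u₁ u₂ u₃ : ℤ) where

  private
    vars : List ℤ
    vars = q₀ ∷ q₁ ∷ q₂ ∷ r₀ ∷ r₁ ∷ r₂ ∷ t₁ ∷ t₂ ∷ s ∷ a₁ ∷ a₂ ∷ n₁ ∷ n₂ ∷ ϱ ∷ k ∷ u₁ ∷ u₂ ∷ u₃ ∷ []

  RHS : ℚᵘ
  RHS = frac a₁ (+ 1) Q.* frac (n₁ - n₂) (q₀ * r₀ * s) Q.* frac u₁ (q₂ * r₂ * t₂ * n₁)
        Q.+ frac (a₂ - a₁) (+ 1) Q.* frac u₂ q₁
        Q.+ frac (a₂ - a₁) (+ 1) Q.* frac u₃ (q₀ * q₂)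
        Q.+ frac a₁ (q₀ * q₁ * q₂ * r₀ * r₁ * r₂ * t₁ * t₂ * s * n₁)

  N : ℤ
  N = a₁ * k * u₁ * (q₀ * q₁ * r₀ * r₁ * t₁ * s)
      + (a₂ - a₁) * u₂ * (q₀ * q₂ * r₀ * r₁ * r₂ * t₁ * t₂ * s * n₁)
      + (a₂ - a₁) * u₃ * (q₁ * r₀ * r₁ * r₂ * t₁ * t₂ * s * n₁) + a₁

  r₀r₁t₁s∣ϱn₁-N : r₀ * r₁ * t₁ * s ∣ ϱ * n₁ - a₁ → r₀ * r₁ * t₁ * s ∣ ϱ * n₁ - N
  r₀r₁t₁s∣ϱn₁-N r₀r₁t₁s∣ϱn₁-a₁ =
    subst (r₀ * r₁ * t₁ * s ∣_) (sym split) (∣m∣n⇒∣m-n r₀r₁t₁s∣ϱn₁-a₁ (∣m⇒∣m*n _ ∣-refl))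
    where
    split : ϱ * n₁ - (a₁ * k * u₁ * (q₀ * q₁ * r₀ * r₁ * t₁ * s)
                      + (a₂ - a₁) * u₂ * (q₀ * q₂ * r₀ * r₁ * r₂ * t₁ * t₂ * s * n₁)
                      + (a₂ - a₁) * u₃ * (q₁ * r₀ * r₁ * r₂ * t₁ * t₂ * s * n₁) + a₁)
          ≡ (ϱ * n₁ - a₁)
            - r₀ * r₁ * t₁ * s * (a₁ * k * u₁ * q₀ * q₁ + (a₂ - a₁) * u₂ * q₀ * q₂ * r₂ * t₂ * n₁
                                  + (a₂ - a₁) * u₃ * q₁ * r₂ * t₂ * n₁)
    split = solve vars

  q₁∣ϱn₁-N : q₀ * q₁ * t₂ ∣ ϱ * n₁ - a₂ → q₁ ∣ q₀ * q₂ * r₀ * r₁ * r₂ * t₁ * t₂ * s * n₁ * u₂ - 1ℤ →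
             q₁ ∣ ϱ * n₁ - N
  q₁∣ϱn₁-N q₀q₁t₂∣ϱn₁-a₂ unit₂ = subst (q₁ ∣_) (sym split)
    (∣m∣n⇒∣m-n (∣m∣n⇒∣m-n q₁∣ϱn₁-a₂ (∣n⇒∣m*n (a₂ - a₁) unit₂)) (∣m⇒∣m*n _ ∣-refl))
    where
    q₁∣ϱn₁-a₂ : q₁ ∣ ϱ * n₁ - a₂
    q₁∣ϱn₁-a₂ = m*n∣⇒n∣ q₀ q₁ (m*n∣⇒m∣ (q₀ * q₁) t₂ q₀q₁t₂∣ϱn₁-a₂)
    split : ϱ * n₁ - (a₁ * k * u₁ * (q₀ * q₁ * r₀ * r₁ * t₁ * s)
                      + (a₂ - a₁) * u₂ * (q₀ * q₂ * r₀ * r₁ * r₂ * t₁ * t₂ * s * n₁)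
                      + (a₂ - a₁) * u₃ * (q₁ * r₀ * r₁ * r₂ * t₁ * t₂ * s * n₁) + a₁)
          ≡ (ϱ * n₁ - a₂) - (a₂ - a₁) * (q₀ * q₂ * r₀ * r₁ * r₂ * t₁ * t₂ * s * n₁ * u₂ - 1ℤ)
            - q₁ * (a₁ * k * u₁ * q₀ * r₀ * r₁ * t₁ * s + (a₂ - a₁) * u₃ * r₀ * r₁ * r₂ * t₁ * t₂ * s * n₁)
    split = solve vars

  q₀∣ϱn₁-N : q₀ * q₂ * t₁ ∣ ϱ * n₂ - a₂ → q₀ * q₂ ∣ q₁ * r₀ * r₁ * r₂ * t₁ * t₂ * s * n₂ * u₃ - 1ℤ →
             q₀ ∣ n₁ - n₂ → q₀ ∣ ϱ * n₁ - N
  q₀∣ϱn₁-N q₀q₂t₁∣ϱn₂-a₂ unit₃ q₀∣n₁-n₂ = ∣-cancel-unitʳ q₀-unit (subst (q₀ ∣_) (sym split)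
    (∣m∣n⇒∣m+n (∣m∣n⇒∣m+n (∣m∣n⇒∣m-n (∣m⇒∣m*n _ ∣-refl) (∣n⇒∣m*n ((a₂ - a₁) * (C * n₁)) q₀-unit))
                          (∣n⇒∣m*n (C * n₁) q₀∣ϱn₂-a₂))
               (∣n⇒∣m*n (C * a₁) q₀∣n₁-n₂)))
    where
    C : ℤ
    C = q₁ * r₀ * r₁ * r₂ * t₁ * t₂ * s
    q₀-unit : q₀ ∣ q₁ * r₀ * r₁ * r₂ * t₁ * t₂ * s * n₂ * u₃ - 1ℤ
    q₀-unit = m*n∣⇒m∣ q₀ q₂ unit₃
    q₀∣ϱn₂-a₂ : q₀ ∣ ϱ * n₂ - a₂
    q₀∣ϱn₂-a₂ = m*n∣⇒m∣ q₀ q₂ (m*n∣⇒m∣ (q₀ * q₂) t₁ q₀q₂t₁∣ϱn₂-a₂)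
    split : (ϱ * n₁ - (a₁ * k * u₁ * (q₀ * q₁ * r₀ * r₁ * t₁ * s)
                       + (a₂ - a₁) * u₂ * (q₀ * q₂ * r₀ * r₁ * r₂ * t₁ * t₂ * s * n₁)
                       + (a₂ - a₁) * u₃ * (q₁ * r₀ * r₁ * r₂ * t₁ * t₂ * s * n₁) + a₁))
            * (q₁ * r₀ * r₁ * r₂ * t₁ * t₂ * s * n₂)
          ≡ q₀ * (- (a₁ * k * u₁ * (q₁ * r₀ * r₁ * t₁ * s)
                     + (a₂ - a₁) * u₂ * (q₂ * r₀ * r₁ * r₂ * t₁ * t₂ * s * n₁))
                  * (q₁ * r₀ * r₁ * r₂ * t₁ * t₂ * s * n₂))
            - (a₂ - a₁) * (q₁ * r₀ * r₁ * r₂ * t₁ * t₂ * s * n₁)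
              * (q₁ * r₀ * r₁ * r₂ * t₁ * t₂ * s * n₂ * u₃ - 1ℤ)
            + q₁ * r₀ * r₁ * r₂ * t₁ * t₂ * s * n₁ * (ϱ * n₂ - a₂)
            + q₁ * r₀ * r₁ * r₂ * t₁ * t₂ * s * a₁ * (n₁ - n₂)
    split = solve vars

  q₂r₂t₂∣[a₂-a₁]u₃c₃+a₁-ϱn₂ : r₀ * r₂ * t₂ * s ∣ ϱ * n₂ - a₁ → q₀ * q₂ * t₁ ∣ ϱ * n₂ - a₂ →
                              q₀ * q₂ ∣ q₁ * r₀ * r₁ * r₂ * t₁ * t₂ * s * n₂ * u₃ - 1ℤ →
                              q₂ * r₂ * t₂ ∣ (a₂ - a₁) * u₃ * (q₁ * r₀ * r₁ * r₂ * t₁ * t₂ * s * n₂) + a₁ - ϱ * n₂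
  q₂r₂t₂∣[a₂-a₁]u₃c₃+a₁-ϱn₂ r₀r₂t₂s∣ϱn₂-a₁ q₀q₂t₁∣ϱn₂-a₂ unit₃ =
    subst (_∣ _) reorder (*∣-via-unit r₂t₂∣c₃ q₂-unit r₂t₂∣ q₂∣)
    where
    q₂-unit : q₂ ∣ q₁ * r₀ * r₁ * r₂ * t₁ * t₂ * s * n₂ * u₃ - 1ℤ
    q₂-unit = m*n∣⇒n∣ q₀ q₂ unit₃
    r₂t₂∣c₃ : r₂ * t₂ ∣ q₁ * r₀ * r₁ * r₂ * t₁ * t₂ * s * n₂
    r₂t₂∣c₃ = divides (q₁ * r₀ * r₁ * t₁ * s * n₂) (solve vars)
    r₂t₂-split : (a₂ - a₁) * u₃ * (q₁ * r₀ * r₁ * r₂ * t₁ * t₂ * s * n₂) + a₁ - ϱ * n₂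
               ≡ r₂ * t₂ * ((a₂ - a₁) * u₃ * (q₁ * r₀ * r₁ * t₁ * s * n₂)) - (ϱ * n₂ - a₁)
    r₂t₂-split = solve vars
    q₂-split : (a₂ - a₁) * u₃ * (q₁ * r₀ * r₁ * r₂ * t₁ * t₂ * s * n₂) + a₁ - ϱ * n₂
             ≡ (a₂ - a₁) * (q₁ * r₀ * r₁ * r₂ * t₁ * t₂ * s * n₂ * u₃ - 1ℤ) - (ϱ * n₂ - a₂)
    q₂-split = solve vars
    r₂t₂∣r₀r₂t₂s : r₂ * t₂ ∣ r₀ * r₂ * t₂ * s
    r₂t₂∣r₀r₂t₂s = divides (r₀ * s) (solve vars)
    r₂t₂∣ : r₂ * t₂ ∣ (a₂ - a₁) * u₃ * (q₁ * r₀ * r₁ * r₂ * t₁ * t₂ * s * n₂) + a₁ - ϱ * n₂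
    r₂t₂∣ = subst (r₂ * t₂ ∣_) (sym r₂t₂-split)
      (∣m∣n⇒∣m-n (∣m⇒∣m*n _ ∣-refl) (∣-trans r₂t₂∣r₀r₂t₂s r₀r₂t₂s∣ϱn₂-a₁))
    q₂∣ : q₂ ∣ (a₂ - a₁) * u₃ * (q₁ * r₀ * r₁ * r₂ * t₁ * t₂ * s * n₂) + a₁ - ϱ * n₂
    q₂∣ = subst (q₂ ∣_) (sym q₂-split)
      (∣m∣n⇒∣m-n (∣n⇒∣m*n (a₂ - a₁) q₂-unit) (m*n∣⇒n∣ q₀ q₂ (m*n∣⇒m∣ (q₀ * q₂) t₁ q₀q₂t₁∣ϱn₂-a₂)))
    reorder : r₂ * t₂ * q₂ ≡ q₂ * r₂ * t₂
    reorder = solve vars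

  q₂r₂t₂n₁∣ϱn₁-N : n₁ - n₂ ≡ k * (q₀ * r₀ * s) → q₂ * r₂ * t₂ * n₁ ∣ q₁ * r₁ * t₁ * n₂ * u₁ - 1ℤ →
                   q₂ * r₂ * t₂ ∣ (a₂ - a₁) * u₃ * (q₁ * r₀ * r₁ * r₂ * t₁ * t₂ * s * n₂) + a₁ - ϱ * n₂ →
                   q₂ * r₂ * t₂ * n₁ ∣ ϱ * n₁ - N
  q₂r₂t₂n₁∣ϱn₁-N n₁-n₂≡kq₀r₀s unit₁ q₂r₂t₂∣ = ∣-cancel-unitʳ unit₁ (subst (B ∣_) (sym split)
    (∣m∣n⇒∣m-n (∣m∣n⇒∣m-n (∣m∣n⇒∣m+n (∣n⇒∣m*n (- (a₁ * k * (q₀ * q₁ * r₀ * r₁ * t₁ * s))) unit₁)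
                                     (∣n⇒∣m*n (a₁ * q₁ * r₁ * t₁) B∣0))
                          (∣n⇒∣m*n ((a₂ - a₁) * u₂ * (q₁ * r₁ * t₁ * n₂) * (q₀ * r₀ * r₁ * t₁ * s)) ∣-refl))
               (∣n⇒∣m*n (q₁ * r₁ * t₁) (*-monoˡ-∣ n₁ q₂r₂t₂∣))))
    where
    B : ℤ
    B = q₂ * r₂ * t₂ * n₁
    B∣0 : B ∣ (n₁ - n₂) - k * (q₀ * r₀ * s)
    B∣0 = subst (B ∣_) (sym (i≡j⇒i-j≡0 n₁-n₂≡kq₀r₀s)) (divides 0ℤ refl)
    split : (ϱ * n₁ - (a₁ * k * u₁ * (q₀ * q₁ * r₀ * r₁ * t₁ * s)
                       + (a₂ - a₁) * u₂ * (q₀ * q₂ * r₀ * r₁ * r₂ * t₁ * t₂ * s * n₁)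
                       + (a₂ - a₁) * u₃ * (q₁ * r₀ * r₁ * r₂ * t₁ * t₂ * s * n₁) + a₁))
            * (q₁ * r₁ * t₁ * n₂)
          ≡ - (a₁ * k * (q₀ * q₁ * r₀ * r₁ * t₁ * s)) * (q₁ * r₁ * t₁ * n₂ * u₁ - 1ℤ)
            + a₁ * q₁ * r₁ * t₁ * ((n₁ - n₂) - k * (q₀ * r₀ * s))
            - (a₂ - a₁) * u₂ * (q₁ * r₁ * t₁ * n₂) * (q₀ * r₀ * r₁ * t₁ * s) * (q₂ * r₂ * t₂ * n₁)
            - q₁ * r₁ * t₁
              * (((a₂ - a₁) * u₃ * (q₁ * r₀ * r₁ * r₂ * t₁ * t₂ * s * n₂) + a₁ - ϱ * n₂) * n₁)
    split = solve vars

  D∣ϱn₁-N :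
    CoprimeZ (q₀ * q₁ * r₀ * r₁ * t₁ * s) (q₂ * r₂ * t₂) →
    CoprimeZ n₁ (q₀ * q₁ * r₀ * r₁ * t₁ * s) →
    ϱ * n₁ ≡ a₁ [mod r₀ * r₁ * t₁ * s ] →
    ϱ * n₂ ≡ a₁ [mod r₀ * r₂ * t₂ * s ] →
    ϱ * n₁ ≡ a₂ [mod q₀ * q₁ * t₂ ] →
    ϱ * n₂ ≡ a₂ [mod q₀ * q₂ * t₁ ] →
    n₁ - n₂ ≡ k * (q₀ * r₀ * s) →
    (q₁ * r₁ * t₁ * n₂) * u₁ ≡ 1ℤ [mod q₂ * r₂ * t₂ * n₁ ] →
    (q₀ * q₂ * r₀ * r₁ * r₂ * t₁ * t₂ * s * n₁) * u₂ ≡ 1ℤ [mod q₁ ] →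
    (q₁ * r₀ * r₁ * r₂ * t₁ * t₂ * s * n₂) * u₃ ≡ 1ℤ [mod q₀ * q₂ ] →
    q₀ * q₁ * q₂ * r₀ * r₁ * r₂ * t₁ * t₂ * s * n₁ ∣ ϱ * n₁ - N
  D∣ϱn₁-N A⊥q₂r₂t₂ n₁⊥A ϱn₁≡a₁ ϱn₂≡a₁ ϱn₁≡a₂ ϱn₂≡a₂ n₁-n₂≡kq₀r₀s unit₁ unit₂ unit₃ =
    subst (_∣ ϱ * n₁ - N) reorder
      (coprime-*∣ (coprime-*ʳ {q₀ * q₁ * r₀ * r₁ * t₁ * s} {q₂ * r₂ * t₂} {n₁} A⊥q₂r₂t₂ (ℕ.sym n₁⊥A))
        (subst (_∣ ϱ * n₁ - N) reorderA A∣)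
        (q₂r₂t₂n₁∣ϱn₁-N n₁-n₂≡kq₀r₀s (∣ᵤ⇒∣ unit₁)
          (q₂r₂t₂∣[a₂-a₁]u₃c₃+a₁-ϱn₂ (∣ᵤ⇒∣ ϱn₂≡a₁) (∣ᵤ⇒∣ ϱn₂≡a₂) (∣ᵤ⇒∣ unit₃))))
    where
    r₀r₁t₁s∣c₂ : r₀ * r₁ * t₁ * s ∣ q₀ * q₂ * r₀ * r₁ * r₂ * t₁ * t₂ * s * n₁
    r₀r₁t₁s∣c₂ = divides (q₀ * q₂ * r₂ * t₂ * n₁) (solve vars)
    r₀r₁t₁sq₁∣c₃ : r₀ * r₁ * t₁ * s * q₁ ∣ q₁ * r₀ * r₁ * r₂ * t₁ * t₂ * s * n₂
    r₀r₁t₁sq₁∣c₃ = divides (r₂ * t₂ * n₂) (solve vars)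
    A∣ : r₀ * r₁ * t₁ * s * q₁ * q₀ ∣ ϱ * n₁ - N
    A∣ = *∣-via-unit r₀r₁t₁sq₁∣c₃ (m*n∣⇒m∣ q₀ q₂ (∣ᵤ⇒∣ unit₃))
           (*∣-via-unit r₀r₁t₁s∣c₂ (∣ᵤ⇒∣ unit₂)
             (r₀r₁t₁s∣ϱn₁-N (∣ᵤ⇒∣ ϱn₁≡a₁)) (q₁∣ϱn₁-N (∣ᵤ⇒∣ ϱn₁≡a₂) (∣ᵤ⇒∣ unit₂)))
           (q₀∣ϱn₁-N (∣ᵤ⇒∣ ϱn₂≡a₂) (∣ᵤ⇒∣ unit₃)
             (divides (k * (r₀ * s)) (trans n₁-n₂≡kq₀r₀s (solve vars))))
    reorderA : r₀ * r₁ * t₁ * s * q₁ * q₀ ≡ q₀ * q₁ * r₀ * r₁ * t₁ * s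
    reorderA = solve vars
    reorder : q₀ * q₁ * r₀ * r₁ * t₁ * s * (q₂ * r₂ * t₂ * n₁)
            ≡ q₀ * q₁ * q₂ * r₀ * r₁ * r₂ * t₁ * t₂ * s * n₁
    reorder = solve vars

  RHS≃N÷D : q₁ ≢ 0ℤ → q₀ * q₂ ≢ 0ℤ → q₀ * r₀ * s ≢ 0ℤ → q₂ * r₂ * t₂ * n₁ ≢ 0ℤ →
             q₀ * q₁ * q₂ * r₀ * r₁ * r₂ * t₁ * t₂ * s * n₁ ≢ 0ℤ → n₁ - n₂ ≡ k * (q₀ * r₀ * s) →
             RHS ≃ N ÷ (q₀ * q₁ * q₂ * r₀ * r₁ * r₂ * t₁ * t₂ * s * n₁)
  RHS≃N÷D q₁≢0 q₀q₂≢0 q₀r₀s≢0 B≢0 D≢0 n₁-n₂≡kq₀r₀s = +-≃÷ (+-≃÷ (+-≃÷ term₁ term₂) term₃) term₄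
    where
    k≃ : frac (n₁ - n₂) (q₀ * r₀ * s) ≃ k ÷ 1ℤ
    k≃ = ≃÷-rescale q₀r₀s≢0 (frac-≃÷ (n₁ - n₂) q₀r₀s≢0) (trans (*-identityʳ (n₁ - n₂)) n₁-n₂≡kq₀r₀s)
    term₁ : frac a₁ (+ 1) Q.* frac (n₁ - n₂) (q₀ * r₀ * s) Q.* frac u₁ (q₂ * r₂ * t₂ * n₁)
          ≃ a₁ * k * u₁ * (q₀ * q₁ * r₀ * r₁ * t₁ * s)
            ÷ (q₀ * q₁ * q₂ * r₀ * r₁ * r₂ * t₁ * t₂ * s * n₁)
    term₁ = ≃÷-rescale (*-≢0 {1ℤ} (λ ()) B≢0) (*-≃÷ (scale-≃÷ a₁ k≃) (frac-≃÷ u₁ B≢0)) (solve vars)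
    term₂ : frac (a₂ - a₁) (+ 1) Q.* frac u₂ q₁
          ≃ (a₂ - a₁) * u₂ * (q₀ * q₂ * r₀ * r₁ * r₂ * t₁ * t₂ * s * n₁)
            ÷ (q₀ * q₁ * q₂ * r₀ * r₁ * r₂ * t₁ * t₂ * s * n₁)
    term₂ = ≃÷-rescale q₁≢0 (scale-≃÷ (a₂ - a₁) (frac-≃÷ u₂ q₁≢0)) (solve vars)
    term₃ : frac (a₂ - a₁) (+ 1) Q.* frac u₃ (q₀ * q₂)
          ≃ (a₂ - a₁) * u₃ * (q₁ * r₀ * r₁ * r₂ * t₁ * t₂ * s * n₁)
            ÷ (q₀ * q₁ * q₂ * r₀ * r₁ * r₂ * t₁ * t₂ * s * n₁)
    term₃ = ≃÷-rescale q₀q₂≢0 (scale-≃÷ (a₂ - a₁) (frac-≃÷ u₃ q₀q₂≢0)) (solve vars)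
    term₄ : frac a₁ (q₀ * q₁ * q₂ * r₀ * r₁ * r₂ * t₁ * t₂ * s * n₁)
          ≃ a₁ ÷ (q₀ * q₁ * q₂ * r₀ * r₁ * r₂ * t₁ * t₂ * s * n₁)
    term₄ = frac-≃÷ a₁ D≢0

∏ : List ℤ → ℤ
∏ = foldr _*_ 1ℤ

coprime-1 : ∀ x → CoprimeZ x 1ℤ
coprime-1 x (_ , d∣1) = ℕ.∣1⇒≡1 d∣1

coprime-∏ʳ : ∀ x ys → All (CoprimeZ x) ys → CoprimeZ x (∏ ys)
coprime-∏ʳ x []       []           = coprime-1 x
coprime-∏ʳ x (y ∷ ys) (x⊥y ∷ x⊥ys) = coprime-*ʳ {x} {y} {∏ ys} x⊥y (coprime-∏ʳ x ys x⊥ys)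

coprime-∏ : ∀ xs ys → All (λ x → All (CoprimeZ x) ys) xs → CoprimeZ (∏ xs) (∏ ys)
coprime-∏ []       ys []               = ℕ.sym (coprime-1 (∏ ys))
coprime-∏ (x ∷ xs) ys (x⊥ys ∷ xs⊥ys) =
  coprime-*ˡ {x} {∏ xs} {∏ ys} (coprime-∏ʳ x ys x⊥ys) (coprime-∏ xs ys xs⊥ys)

q₀q₁r₀r₁t₁s⊥q₂r₂t₂ : ∀ {q₀ q₁ q₂ r₀ r₁ r₂ t₁ t₂ s} →
  AllPairs CoprimeZ (q₀ ∷ q₁ ∷ q₂ ∷ r₀ ∷ r₁ ∷ r₂ ∷ t₁ ∷ t₂ ∷ s ∷ []) →
  CoprimeZ (q₀ * q₁ * r₀ * r₁ * t₁ * s) (q₂ * r₂ * t₂)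
q₀q₁r₀r₁t₁s⊥q₂r₂t₂ {q₀} {q₁} {q₂} {r₀} {r₁} {r₂} {t₁} {t₂} {s}
  ((_ ∷ q₀q₂ ∷ _ ∷ _ ∷ q₀r₂ ∷ _ ∷ q₀t₂ ∷ _ ∷ []) ∷
   (q₁q₂ ∷ _ ∷ _ ∷ q₁r₂ ∷ _ ∷ q₁t₂ ∷ _ ∷ []) ∷
   (q₂r₀ ∷ q₂r₁ ∷ _ ∷ q₂t₁ ∷ _ ∷ q₂s ∷ []) ∷
   (_ ∷ r₀r₂ ∷ _ ∷ r₀t₂ ∷ _ ∷ []) ∷
   (r₁r₂ ∷ _ ∷ r₁t₂ ∷ _ ∷ []) ∷
   (r₂t₁ ∷ _ ∷ r₂s ∷ []) ∷
   (t₁t₂ ∷ _ ∷ []) ∷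
   (t₂s ∷ []) ∷ [] ∷ []) =
  subst₂ CoprimeZ (∏₆ q₀ q₁ r₀ r₁ t₁ s) (∏₃ q₂ r₂ t₂)
    (coprime-∏ (q₀ ∷ q₁ ∷ r₀ ∷ r₁ ∷ t₁ ∷ s ∷ []) (q₂ ∷ r₂ ∷ t₂ ∷ [])
      ( (q₀q₂       ∷ q₀r₂       ∷ q₀t₂       ∷ [])
      ∷ (q₁q₂       ∷ q₁r₂       ∷ q₁t₂       ∷ [])
      ∷ (ℕ.sym q₂r₀ ∷ r₀r₂       ∷ r₀t₂       ∷ [])
      ∷ (ℕ.sym q₂r₁ ∷ r₁r₂       ∷ r₁t₂       ∷ [])
      ∷ (ℕ.sym q₂t₁ ∷ ℕ.sym r₂t₁ ∷ t₁t₂       ∷ [])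
      ∷ (ℕ.sym q₂s  ∷ ℕ.sym r₂s  ∷ ℕ.sym t₂s  ∷ [])
      ∷ []))
  where
  ∏₆ : ∀ a b c d e f → a * (b * (c * (d * (e * (f * 1ℤ))))) ≡ a * b * c * d * e * f
  ∏₆ = solve-∀
  ∏₃ : ∀ a b c → a * (b * (c * 1ℤ)) ≡ a * b * c
  ∏₃ = solve-∀

lemma2p5 : ∀ (q₀ q₁ q₂ r₀ r₁ r₂ t₁ t₂ s a₁ a₂ n₁ n₂ ϱ : ℤ) →
    0ℤ < q₀ → 0ℤ < q₁ → 0ℤ < q₂ → 0ℤ < r₀ → 0ℤ < r₁ → 0ℤ < r₂ →
    0ℤ < t₁ → 0ℤ < t₂ → 0ℤ < s →
    AllPairs CoprimeZ (q₀ ∷ q₁ ∷ q₂ ∷ r₀ ∷ r₁ ∷ r₂ ∷ t₁ ∷ t₂ ∷ s ∷ []) →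
    CoprimeZ n₁ (q₀ * q₁ * r₀ * r₁ * t₁ * s) →
    CoprimeZ n₂ (q₀ * q₂ * r₀ * r₂ * t₂ * s) →
    CoprimeZ n₁ n₂ →
    n₁ ≢ 0ℤ →
    ϱ * n₁ ≡ a₁ [mod r₀ * r₁ * t₁ * s ] →
    ϱ * n₂ ≡ a₁ [mod r₀ * r₂ * t₂ * s ] →
    ϱ * n₁ ≡ a₂ [mod q₀ * q₁ * t₂ ] →
    ϱ * n₂ ≡ a₂ [mod q₀ * q₂ * t₁ ] →
    n₁ ≡ n₂ [mod q₀ * r₀ * s ] →
    a₂ * n₁ ≡ a₁ * n₂ [mod t₁ ] →
    a₁ * n₁ ≡ a₂ * n₂ [mod t₂ ] →
    -- arbitrary choices of the modular inverses appearing in the statement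
    ∀ (u₁ u₂ u₃ : ℤ) →
    (q₁ * r₁ * t₁ * n₂) * u₁ ≡ 1ℤ [mod q₂ * r₂ * t₂ * n₁ ] →
    (q₀ * q₂ * r₀ * r₁ * r₂ * t₁ * t₂ * s * n₁) * u₂ ≡ 1ℤ [mod q₁ ] →
    (q₁ * r₀ * r₁ * r₂ * t₁ * t₂ * s * n₂) * u₃ ≡ 1ℤ [mod q₀ * q₂ ] →
    frac ϱ (q₀ * q₁ * q₂ * r₀ * r₁ * r₂ * t₁ * t₂ * s)
      ≡₁
    ((Q._+_ (Q._+_ (Q._+_
      (Q._*_ (Q._*_ (frac a₁ (+ 1)) (frac (n₁ - n₂) (q₀ * r₀ * s)))
                    (frac u₁ (q₂ * r₂ * t₂ * n₁)))
      (Q._*_ (frac (a₂ - a₁) (+ 1)) (frac u₂ q₁)))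
      (Q._*_ (frac (a₂ - a₁) (+ 1)) (frac u₃ (q₀ * q₂))))
      (frac a₁ (q₀ * q₁ * q₂ * r₀ * r₁ * r₂ * t₁ * t₂ * s * n₁))))
lemma2p5 q₀ q₁ q₂ r₀ r₁ r₂ t₁ t₂ s a₁ a₂ n₁ n₂ ϱ 0<q₀ 0<q₁ 0<q₂ 0<r₀ 0<r₁ 0<r₂ 0<t₁ 0<t₂ 0<s
         pairwise n₁⊥ _ _ n₁≢0 ϱn₁≡a₁ ϱn₂≡a₁ ϱn₁≡a₂ ϱn₂≡a₂ n₁≡n₂ _ _ u₁ u₂ u₃ unit₁ unit₂ unit₃
  with ∣ᵤ⇒∣ {q₀ * r₀ * s} {n₁ - n₂} n₁≡n₂
... | divides k n₁-n₂≡kq₀r₀s =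
  ≡₁-by-÷ D≢0 (≃÷-extend n₁ (frac-≃÷ ϱ Q≢0)) (RHS≃N÷D q₁≢0 q₀q₂≢0 q₀r₀s≢0 B≢0 D≢0 n₁-n₂≡kq₀r₀s)
    (D∣ϱn₁-N (q₀q₁r₀r₁t₁s⊥q₂r₂t₂ pairwise) n₁⊥ ϱn₁≡a₁ ϱn₂≡a₁ ϱn₁≡a₂ ϱn₂≡a₂
                       n₁-n₂≡kq₀r₀s unit₁ unit₂ unit₃)
  where
  open Numerator q₀ q₁ q₂ r₀ r₁ r₂ t₁ t₂ s a₁ a₂ n₁ n₂ ϱ k u₁ u₂ u₃
  ≢0 : ∀ {x} → 0ℤ < x → x ≢ 0ℤ
  ≢0 0<x = ≢-sym (<⇒≢ 0<x)
  q₁≢0 : q₁ ≢ 0ℤ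
  q₁≢0 = ≢0 0<q₁
  q₀q₂≢0 : q₀ * q₂ ≢ 0ℤ
  q₀q₂≢0 = *-≢0 (≢0 0<q₀) (≢0 0<q₂)
  q₀r₀s≢0 : q₀ * r₀ * s ≢ 0ℤ
  q₀r₀s≢0 = *-≢0 (*-≢0 (≢0 0<q₀) (≢0 0<r₀)) (≢0 0<s)
  B≢0 : q₂ * r₂ * t₂ * n₁ ≢ 0ℤ
  B≢0 = *-≢0 (*-≢0 (*-≢0 (≢0 0<q₂) (≢0 0<r₂)) (≢0 0<t₂)) n₁≢0
  Q≢0 : q₀ * q₁ * q₂ * r₀ * r₁ * r₂ * t₁ * t₂ * s ≢ 0ℤ
  Q≢0 = *-≢0 (*-≢0 (*-≢0 (*-≢0 (*-≢0 (*-≢0 (*-≢0 (*-≢0 (≢0 0<q₀) q₁≢0) (≢0 0<q₂)) (≢0 0<r₀))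
          (≢0 0<r₁)) (≢0 0<r₂)) (≢0 0<t₁)) (≢0 0<t₂)) (≢0 0<s)
  D≢0 : q₀ * q₁ * q₂ * r₀ * r₁ * r₂ * t₁ * t₂ * s * n₁ ≢ 0ℤ
  D≢0 = *-≢0 Q≢0 n₁≢0
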